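{- Let $n_0\in\mathbb{N}$ and, for $i\in\mathbb{N}$, let $n_i=3n_{i-1}+d_i$ with $d_i\in\{1,2,3\}$. Let $S_{n_{i-1}}$ be the total number of brushes of a $1$-clique configuration of $K_{n_{i-1}}$. Then there exists an initial $1$-clique configuration of $K_{n_i}$ using $2\cdot S_{n_{i-1}}+\frac{1}{3}n_i^2+O(n_i)$ brushes.
   Context: $K_n$ is the complete graph on $n$ vertices. Parallel cleaning process on a graph $G=(V,E)$ with initial configuration $\omega_0:V\to\mathbb{N}\cup\{0\}$: $D_0=V$, $t=0$; $D_t(v)=|N(v)\cap D_t|$ if $v\in D_t$, else $0$; $\rho_{t+1}=\{v\in D_t:\omega_t(v)\ge D_t(v)\}$; if $\rho_{t+1}=\emptyset$ stop with $K=t$, final dirty set $D_K$ and final configuration $\omega_K$; otherwise $D_{t+1}=D_t\setminus\rho_{t+1}$, $\omega_{t+1}(v)=\omega_t(v)-D_t(v)+|N(v)\cap\rho_{t+1}|$ for $v\in\rho_{t+1}$, $\omega_{t+1}(u)=\omega_t(u)+|N(u)\cap\rho_{t+1}|$ for $u\in D_{t+1}$, other values unchanged, and repeat with $t+1$. $\omega_0$ cleans $G$ if $D_K=\emptyset$. A $1$-clique configuration of $K_n$ (vertices $v_0,\dots,v_{n-1}$) is an initial configuration $\omega_0$ that cleans $K_n$ with final configuration $\omega_K$ such that (1) $\omega_0(v_i)\le n-1$ for all $i$, and (2) there is a one-to-one correspondence between the elements of $\{\omega_0(v_0),\dots,\omega_0(v_{n-1})\}$ and $\{\omega_K(v_0),\dots,\omega_K(v_{n-1})\}$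 (i.e. $\omega_K$ is obtained from $\omega_0$ by relabeling the vertices). The number of brushes used by $\omega_0$ is $\sum_i\omega_0(v_i)$. -}

module Defs where

open import Data.Nat using (ℕ; zero; suc; _+_; _*_; _∸_; _≤_; _≤ᵇ_; _≡ᵇ_)
open import Data.Bool using (Bool; true; false; _∧_; not; if_then_else_)
open import Data.Fin using (Fin)
open import Data.Fin.Properties using (_≟_)
open import Data.Fin.Permutation using (Permutation′; _⟨$⟩ʳ_)
open import Data.List using (List; map; allFin)
open import Data.Nat.ListAction using (sum)
open import Data.Product using (Σ; _×_; _,_; proj₁; proj₂)
open import Relation.Binary.PropositionalEquality using (_≡_)
open import Relation.Nullary.Decidable using (⌊_⌋)

-- A graph on vertex set Fin n, given by its (symmetric, irreflexive) adjacency test.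
Graph : ℕ → Set
Graph n = Fin n → Fin n → Bool

complete : (n : ℕ) → Graph n
complete n u v = not ⌊ u ≟ v ⌋

-- Configurations (brushes per vertex) and vertex subsets (dirty sets etc.).
Config : ℕ → Set
Config n = Fin n → ℕ

VSet : ℕ → Set
VSet n = Fin n → Bool

card : {n : ℕ} → VSet n → ℕ
card {n} S = sum (map (λ i → if S i then 1 else 0) (allFin n))

nbrsIn : {n : ℕ} → Graph n → VSet n → Fin n → ℕ
nbrsIn G S v = card (λ u → G v u ∧ S u)

dirtyDeg : {n : ℕ} → Graph n → VSet n → Fin n → ℕ
dirtyDeg G D v = if D v then nbrsIn G D v else 0

toClean : {n : ℕ} → Graph n → VSet n → Config n → VSet n
toClean G D ω v = D v ∧ (dirtyDeg G D v ≤ᵇ ω v)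

State : ℕ → Set
State n = VSet n × Config n

step : {n : ℕ} → Graph n → State n → State n
step G (D , ω) =
  if card ρ ≡ᵇ 0 then (D , ω) else (D′ , ω′)
  where
  ρ : VSet _
  ρ = toClean G D ω
  D′ : VSet _
  D′ v = D v ∧ not (ρ v)
  ω′ : Config _
  ω′ v = if ρ v then (ω v ∸ dirtyDeg G D v) + nbrsIn G ρ v
         else (if D′ v then ω v + nbrsIn G ρ v else ω v)

iterate : {A : Set} → ℕ → (A → A) → A → A
iterate zero    f a = a
iterate (suc k) f a = iterate k f (f a)

-- Every non-stopping round removes at least one
-- vertex, so the process stops after at most n rounds; after that, step is
-- the identity. Hence n rounds reach the final state.
final : {n : ℕ} → Graph n → Config n → State n
final {n} G ω₀ = iterate n (step G) ((λ _ → true) , ω₀)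

finalDirty : {n : ℕ} → Graph n → Config n → VSet n
finalDirty G ω₀ = proj₁ (final G ω₀)

finalConfig : {n : ℕ} → Graph n → Config n → Config n
finalConfig G ω₀ = proj₂ (final G ω₀)

Cleans : {n : ℕ} → Graph n → Config n → Set
Cleans {n} G ω₀ = (v : Fin n) → finalDirty G ω₀ v ≡ false

brushes : {n : ℕ} → Config n → ℕ
brushes {n} ω = sum (map ω (allFin n))

OneClique : (n : ℕ) → Config n → Set
OneClique n ω₀ =
  Cleans (complete n) ω₀
  × ((v : Fin n) → ω₀ v ≤ n ∸ 1)
  × Σ (Permutation′ n) (λ π → (v : Fin n) → finalConfig (complete n) ω₀ (π ⟨$⟩ʳ v) ≡ ω₀ v)

-- Split the vertices of K_N, N = 3m + d, into blocks X and Y of size m and Z of size m + d.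
-- Given a 1-clique configuration ω of K_m, put ω x + |Y ∪ Z| brushes on the x-th vertex of X,
-- ω y on the y-th vertex of Y and m + d - 1 on every vertex of Z. While X is dirty all of
-- Y ∪ Z stays dirty, so X is cleaned exactly as K_m is cleaned from ω (the surplus |Y ∪ Z|
-- pays for the edges into Y ∪ Z), and each cleaned X-vertex sends one brush to every vertex
-- of Y ∪ Z. Once X is clean, Z fires as a whole, and in the next round so does Y. Then X
-- holds the final configuration of K_m, a relabelling of ω, and Y holds ω y + |Y ∪ Z|: the
-- final configuration is the initial one with X and Y exchanged. The initial configuration
-- uses 2S + m(2m + d) + (m + d)(m + d - 1) = 2S + N²/3 + O(N) brushes.
module Submission where

open import Defs
open import Data.Bool using (Bool; true; false; _∧_; not; if_then_else_)
open import Data.Bool.Properties using (∧-inverseʳ; ∧-identityʳ; T-≡; ¬-not)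
open import Data.Fin using (Fin; zero; suc; splitAt)
open import Data.Fin.Properties using (_≟_; +↔⊎)
open import Data.Fin.Permutation using (Permutation′; _⟨$⟩ʳ_; _⟨$⟩ˡ_; inverseˡ; inverseʳ) renaming (id to idₚ)
open import Data.List using (map; allFin; tabulate)
open import Data.List.Properties using (map-tabulate)
open import Data.Nat using (ℕ; zero; suc; _+_; _*_; _∸_; _≤_; _<_; _≤ᵇ_; _≡ᵇ_; _≤?_; z≤n; s≤s)
open import Data.Nat.ListAction as List using ()
open import Data.Nat.Properties hiding (_≟_)
open import Data.Nat.Tactic.RingSolver using (solve-∀)
open import Data.Product using (_,_; proj₁; proj₂; _×_; ∃-syntax)
open import Data.Product.Relation.Binary.Pointwise.NonDependent using (_×ₛ_)
open import Data.Sum using (_⊎_; inj₁; inj₂; map₁)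
import Data.Sum as Sum
open import Data.Sum.Function.Propositional using (_⊎-↔_)
open import Function using (_∘_; id; Equivalence; Inverse; _↔_; mk↔ₛ′)
open import Function.Properties.Inverse using (↔-refl; ↔-sym; ↔-trans)
open import Relation.Binary using (Setoid)
open import Relation.Binary.PropositionalEquality
open import Relation.Nullary.Decidable using (⌊_⌋; yes; no)
open import Relation.Nullary.Negation using (contradiction)

open import Algebra.Properties.CommutativeMonoid.Sum +-0-commutativeMonoid
  using (sum-syntax; sum-cong-≗; ∑-distrib-+)

indicator : Bool → ℕ
indicator b = if b then 1 else 0

sum-tabulate : ∀ {n} (f : Fin n → ℕ) → List.sum (tabulate f) ≡ ∑[ i < n ] f i
sum-tabulate {zero}  f = refl
sum-tabulate {suc n} f = cong (f zero +_) (sum-tabulate (f ∘ suc))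

sum-map-allFin : ∀ {n} (f : Fin n → ℕ) → List.sum (map f (allFin n)) ≡ ∑[ i < n ] f i
sum-map-allFin f = trans (cong List.sum (map-tabulate id f)) (sum-tabulate f)

∑-const : ∀ n c → ∑[ i < n ] c ≡ n * c
∑-const zero    c = refl
∑-const (suc n) c = cong (c +_) (∑-const n c)

∑-splitAt : ∀ a {b} (g : Fin a ⊎ Fin b → ℕ) →
            ∑[ i < a + b ] g (splitAt a i) ≡ ∑[ i < a ] g (inj₁ i) + ∑[ j < b ] g (inj₂ j)
∑-splitAt zero    g = refl
∑-splitAt (suc a) g =
  trans (cong (g (inj₁ zero) +_) (∑-splitAt a (g ∘ map₁ suc))) (sym (+-assoc (g (inj₁ zero)) _ _))

∅ : ∀ {n} → VSet n
∅ _ = false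

full : ∀ {n} → VSet n
full _ = true

∁ : ∀ {n} → VSet n → VSet n
∁ S v = not (S v)

_∖_ : ∀ {n} → VSet n → VSet n → VSet n
(D ∖ R) v = D v ∧ not (R v)

_⊆_ : ∀ {n} → VSet n → VSet n → Set
R ⊆ D = ∀ v → D v ≡ false → R v ≡ false

card≡∑ : ∀ {n} (S : VSet n) → card S ≡ ∑[ i < n ] indicator (S i)
card≡∑ S = sum-map-allFin (indicator ∘ S)

card-cong : ∀ {n} {S S′ : VSet n} → S ≗ S′ → card S ≡ card S′
card-cong {S = S} {S′} S≗S′ =
  trans (card≡∑ S) (trans (sum-cong-≗ (cong indicator ∘ S≗S′)) (sym (card≡∑ S′)))

card-full : ∀ n → card (full {n}) ≡ n
card-full n = trans (card≡∑ (full {n})) (trans (∑-const n 1) (*-identityʳ n))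

card-∅ : ∀ n → card (∅ {n}) ≡ 0
card-∅ n = trans (card≡∑ (∅ {n})) (trans (∑-const n 0) (*-zeroʳ n))

card≡0⇒∅ : ∀ {n} (S : VSet n) → card S ≡ 0 → S ≗ ∅
card≡0⇒∅ S h = ∑≡0 (trans (sym (card≡∑ S)) h)
  where
  indicator≡0 : ∀ {b} → indicator b ≡ 0 → b ≡ false
  indicator≡0 {false} _ = refl
  ∑≡0 : ∀ {n} {S : VSet n} → ∑[ i < n ] indicator (S i) ≡ 0 → S ≗ ∅
  ∑≡0 {S = S} h zero    = indicator≡0 (m+n≡0⇒m≡0 (indicator (S zero)) h)
  ∑≡0 {S = S} h (suc i) = ∑≡0 (m+n≡0⇒n≡0 (indicator (S zero)) h) i

card+card-∁ : ∀ {n} (S : VSet n) → card S + card (∁ S) ≡ n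
card+card-∁ {n} S = begin
  card S + card (∁ S)
    ≡⟨ cong₂ _+_ (card≡∑ S) (card≡∑ (∁ S)) ⟩
  ∑[ i < n ] indicator (S i) + ∑[ i < n ] indicator (∁ S i)
    ≡⟨ ∑-distrib-+ (indicator ∘ S) (indicator ∘ ∁ S) ⟨
  ∑[ i < n ] (indicator (S i) + indicator (∁ S i))
    ≡⟨ sum-cong-≗ (indicator-split ∘ S) ⟩
  ∑[ i < n ] 1
    ≡⟨ ∑-const n 1 ⟩
  n * 1
    ≡⟨ *-identityʳ n ⟩
  n ∎
  where
  open ≡-Reasoning
  indicator-split : ∀ b → indicator b + indicator (not b) ≡ 1
  indicator-split true  = refl
  indicator-split false = refl

card-∁≤ : ∀ {n} (S : VSet n) → card (∁ S) ≤ n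
card-∁≤ S = subst (card (∁ S) ≤_) (card+card-∁ S) (m≤n+m _ (card S))

card-∁-∖ : ∀ {n} {D R : VSet n} → R ⊆ D → card (∁ (D ∖ R)) ≡ card (∁ D) + card R
card-∁-∖ {n} {D} {R} R⊆D = begin
  card (∁ (D ∖ R))
    ≡⟨ card≡∑ (∁ (D ∖ R)) ⟩
  ∑[ i < n ] indicator (∁ (D ∖ R) i)
    ≡⟨ sum-cong-≗ (λ i → pointwise (D i) (R i) (R⊆D i)) ⟩
  ∑[ i < n ] (indicator (∁ D i) + indicator (R i))
    ≡⟨ ∑-distrib-+ (indicator ∘ ∁ D) (indicator ∘ R) ⟩
  ∑[ i < n ] indicator (∁ D i) + ∑[ i < n ] indicator (R i)
    ≡⟨ cong₂ _+_ (card≡∑ (∁ D)) (card≡∑ R) ⟨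
  card (∁ D) + card R ∎
  where
  open ≡-Reasoning
  pointwise : ∀ d r → (d ≡ false → r ≡ false) →
              indicator (not (d ∧ not r)) ≡ indicator (not d) + indicator r
  pointwise true  true  _ = refl
  pointwise true  false _ = refl
  pointwise false false _ = refl
  pointwise false true  h = contradiction (h refl) λ ()

nbrsIn-complete : ∀ {n} (S : VSet n) v → nbrsIn (complete n) S v ≡ card S ∸ indicator (S v)
nbrsIn-complete {n} S v = begin
  nbrsIn (complete n) S v
    ≡⟨ m+n∸n≡m _ (indicator (S v)) ⟨
  nbrsIn (complete n) S v + indicator (S v) ∸ indicator (S v)
    ≡⟨ cong (_∸ indicator (S v)) others ⟩
  card S ∸ indicator (S v) ∎
  where
  open ≡-Reasoning
  ∑-others : ∀ {n} (S : VSet n) v →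
             ∑[ u < n ] indicator (complete n v u ∧ S u) + indicator (S v) ≡ ∑[ u < n ] indicator (S u)
  ∑-others S zero    = +-comm _ (indicator (S zero))
  ∑-others S (suc v) =
    trans (+-assoc (indicator (S zero)) _ _)
          (cong (indicator (S zero) +_)
                (trans (cong (_+ indicator (S (suc v)))
                             (sum-cong-≗ λ u → cong (λ b → indicator (not b ∧ S (suc u))) (≟-suc v u)))
                       (∑-others (S ∘ suc) v)))
    where
    ≟-suc : ∀ {n} (v u : Fin n) → ⌊ suc v ≟ suc u ⌋ ≡ ⌊ v ≟ u ⌋
    ≟-suc v u with v ≟ u
    ... | yes _ = refl
    ... | no  _ = refl
  others : nbrsIn (complete n) S v + indicator (S v) ≡ card S
  others = trans (cong (_+ indicator (S v)) (card≡∑ {n} (λ u → complete n v u ∧ S u)))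
                 (trans (∑-others S v) (sym (card≡∑ S)))

≤ᵇ-true : ∀ {a b} → a ≤ b → (a ≤ᵇ b) ≡ true
≤ᵇ-true a≤b = Equivalence.to T-≡ (≤⇒≤ᵇ a≤b)

≤ᵇ-false : ∀ {a b} → b < a → (a ≤ᵇ b) ≡ false
≤ᵇ-false {a} {b} b<a = ¬-not λ a≤ᵇb → <⇒≱ b<a (≤ᵇ⇒≤ a b (Equivalence.from T-≡ a≤ᵇb))

≤ᵇ-+ʳ : ∀ a b c → (a + c ≤ᵇ b + c) ≡ (a ≤ᵇ b)
≤ᵇ-+ʳ a b c with a ≤? b
... | yes a≤b = trans (≤ᵇ-true (+-monoˡ-≤ c a≤b)) (sym (≤ᵇ-true a≤b))
... | no  a≰b = trans (≤ᵇ-false (+-monoˡ-< c (≰⇒> a≰b))) (sym (≤ᵇ-false (≰⇒> a≰b)))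

-- Without function extensionality, states are compared pointwise.
stateSetoid : ℕ → Setoid _ _
stateSetoid n = (Fin n →-setoid Bool) ×ₛ (Fin n →-setoid ℕ)

module _ {n : ℕ} where
  open Setoid (stateSetoid n) public
    using () renaming (_≈_ to _≋_; refl to ≋-refl; sym to ≋-sym; trans to ≋-trans)

-- The weight update of Defs.step as a function of its ingredients, so that it can be
-- transported along pointwise equalities.
weightAfter : Bool → Bool → ℕ → ℕ → ℕ → ℕ
weightAfter fires staysDirty w deg gain =
  if fires then w ∸ deg + gain else if staysDirty then w + gain else w

weightAfter-cong : ∀ {r r′ s s′ w w′ k k′ g g′} →
                   r ≡ r′ → s ≡ s′ → w ≡ w′ → k ≡ k′ → g ≡ g′ →
                   weightAfter r s w k g ≡ weightAfter r′ s′ w′ k′ g′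
weightAfter-cong refl refl refl refl refl = refl

dirtyDeg-cong : ∀ {n} (G : Graph n) {D D′ : VSet n} → D ≗ D′ → dirtyDeg G D ≗ dirtyDeg G D′
dirtyDeg-cong G D≗D′ v =
  cong₂ (λ b k → if b then k else 0) (D≗D′ v) (card-cong λ u → cong (G v u ∧_) (D≗D′ u))

toClean-cong : ∀ {n} (G : Graph n) {s s′ : State n} → s ≋ s′ →
               toClean G (proj₁ s) (proj₂ s) ≗ toClean G (proj₁ s′) (proj₂ s′)
toClean-cong G (D≗D′ , ω≗ω′) v =
  cong₂ _∧_ (D≗D′ v) (cong₂ _≤ᵇ_ (dirtyDeg-cong G D≗D′ v) (ω≗ω′ v))

step-cong : ∀ {n} (G : Graph n) {s s′ : State n} → s ≋ s′ → step G s ≋ step G s′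
step-cong G {D , ω} {D′ , ω′} s≋s′@(D≗D′ , ω≗ω′) rewrite card-cong (toClean-cong G s≋s′)
  with card (toClean G D′ ω′) ≡ᵇ 0
... | true  = s≋s′
... | false = stays , λ v → weightAfter-cong (ρ≗ρ′ v) (stays v) (ω≗ω′ v) (dirtyDeg-cong G D≗D′ v)
                                              (card-cong λ u → cong (G v u ∧_) (ρ≗ρ′ u))
  where
  ρ≗ρ′ : toClean G D ω ≗ toClean G D′ ω′
  ρ≗ρ′ = toClean-cong G s≋s′
  stays : ∀ v → D v ∧ not (toClean G D ω v) ≡ D′ v ∧ not (toClean G D′ ω′ v)
  stays v = cong₂ (λ b r → b ∧ not r) (D≗D′ v) (ρ≗ρ′ v)

iterate-cong : ∀ {n} (G : Graph n) k {s s′ : State n} → s ≋ s′ →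
               iterate k (step G) s ≋ iterate k (step G) s′
iterate-cong G zero    s≋s′ = s≋s′
iterate-cong G (suc k) s≋s′ = iterate-cong G k (step-cong G s≋s′)

cleanable : ∀ {n} → VSet n → Config n → VSet n
cleanable D ω v = D v ∧ (card D ∸ 1 ≤ᵇ ω v)

afterRound : ∀ {n} → VSet n → Config n → VSet n → State n
afterRound D ω R = D ∖ R , λ v → if R v then ω v ∸ (card D ∸ 1) + (card R ∸ 1)
                                 else if D v then ω v + card R else ω v

dirtyDeg-complete : ∀ {n} (D : VSet n) v → dirtyDeg (complete n) D v ≡ (if D v then card D ∸ 1 else 0)
dirtyDeg-complete D v with D v in Dv
... | true  = trans (nbrsIn-complete D v) (cong (λ b → card D ∸ indicator b) Dv)
... | false = refl

toClean-complete : ∀ {n} (D : VSet n) ω → toClean (complete n) D ω ≗ cleanable D ω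
toClean-complete D ω v with D v in Dv
... | true  = cong (_≤ᵇ ω v) (trans (nbrsIn-complete D v) (cong (λ b → card D ∸ indicator b) Dv))
... | false = refl

step-complete-idle : ∀ {n} {D : VSet n} {ω} → cleanable D ω ≗ ∅ → step (complete n) (D , ω) ≋ (D , ω)
step-complete-idle {n} {D} {ω} none
  rewrite trans (card-cong λ v → trans (toClean-complete D ω v) (none v)) (card-∅ n) = ≋-refl

step-complete-fire : ∀ {n} {D : VSet n} {ω R r} → cleanable D ω ≗ R → card R ≡ suc r →
                     step (complete n) (D , ω) ≋ afterRound D ω R
step-complete-fire {n} {D} {ω} {R} {r} cleanable≗R |R|
  rewrite trans (card-cong λ v → trans (toClean-complete D ω v) (cleanable≗R v)) |R|
  = (λ v → cong (λ b → D v ∧ not b) (ρ≗R v)) , weight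
  where
  ρ≗R : toClean (complete n) D ω ≗ R
  ρ≗R v = trans (toClean-complete D ω v) (cleanable≗R v)
  R⇒D : ∀ v → R v ≡ true → D v ≡ true
  R⇒D v Rv = ∧-trueˡ (trans (cleanable≗R v) Rv)
    where
    ∧-trueˡ : ∀ {a b} → a ∧ b ≡ true → a ≡ true
    ∧-trueˡ {true} _ = refl
  fired : ∀ fires d w c k → (fires ≡ true → d ≡ true) →
          weightAfter fires (d ∧ not fires) w (if d then c else 0) (suc k ∸ indicator fires)
          ≡ (if fires then w ∸ c + k else if d then w + suc k else w)
  fired true  true  _ _ _ _ = refl
  fired true  false _ _ _ h = contradiction (h refl) λ ()
  fired false true  _ _ _ _ = refl
  fired false false _ _ _ _ = refl
  weight : ∀ v → weightAfter (toClean (complete n) D ω v) (D v ∧ not (toClean (complete n) D ω v)) (ω v)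
                               (dirtyDeg (complete n) D v) (nbrsIn (complete n) (toClean (complete n) D ω) v)
               ≡ (if R v then ω v ∸ (card D ∸ 1) + (card R ∸ 1) else if D v then ω v + card R else ω v)
  weight v =
    trans (weightAfter-cong (ρ≗R v) (cong (λ b → D v ∧ not b) (ρ≗R v)) refl (dirtyDeg-complete D v)
            (trans (nbrsIn-complete _ v) (cong₂ _∸_ (trans (card-cong ρ≗R) |R|) (cong indicator (ρ≗R v)))))
          (trans (fired (R v) (D v) (ω v) (card D ∸ 1) r (R⇒D v))
                 (cong (λ c → if R v then ω v ∸ (card D ∸ 1) + (c ∸ 1) else if D v then ω v + c else ω v)
                       (sym |R|)))

step-complete-all : ∀ {n} {D : VSet n} {ω} → (∀ v → D v ≡ true → card D ∸ 1 ≤ ω v) →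
                    step (complete n) (D , ω) ≋ (∅ , ω)
step-complete-all {n} {D} {ω} enough = byCard (card D) refl
  where
  cleanable≗D : cleanable D ω ≗ D
  cleanable≗D v with D v in Dv
  ... | true  = ≤ᵇ-true (enough v Dv)
  ... | false = refl
  weight : ∀ v → (if D v then ω v ∸ (card D ∸ 1) + (card D ∸ 1)
                  else if D v then ω v + card D else ω v) ≡ ω v
  weight v with D v in Dv
  ... | true  = m∸n+n≡m (enough v Dv)
  ... | false = refl
  byCard : ∀ c → card D ≡ c → step (complete n) (D , ω) ≋ (∅ , ω)
  byCard zero    |D| =
    ≋-trans (step-complete-idle λ v → cong (_∧ (card D ∸ 1 ≤ᵇ ω v)) (D≗∅ v)) (D≗∅ , λ _ → refl)
    where
    D≗∅ : D ≗ ∅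
    D≗∅ = card≡0⇒∅ D |D|
  byCard (suc r) |D| = ≋-trans (step-complete-fire cleanable≗D |D|) (∧-inverseʳ ∘ D , weight)

iterate-complete-clean : ∀ {n} k {D : VSet n} {ω} → D ≗ ∅ →
                         iterate k (step (complete n)) (D , ω) ≋ (∅ , ω)
iterate-complete-clean zero    D≗∅ = D≗∅ , λ _ → refl
iterate-complete-clean (suc k) D≗∅ =
  ≋-trans (iterate-cong (complete _) k
             (step-complete-all λ v Dv → contradiction (trans (sym Dv) (D≗∅ v)) λ ()))
          (iterate-complete-clean k λ _ → refl)

module BlowUp (m e : ℕ) where

  d : ℕ
  d = suc e

  N : ℕ
  N = 3 * m + d

  data Part : Set where
    X Y : Fin m → Part
    Z   : Part

  -- 3 * m unfolds to m + (m + 1 * m); Z is the block Fin (1 * m) together with Fin d.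
  Layout : Set
  Layout = (Fin m ⊎ Fin m ⊎ Fin (1 * m)) ⊎ Fin d

  layout : Fin N ↔ Layout
  layout = ↔-trans +↔⊎ (↔-trans +↔⊎ (↔-refl ⊎-↔ +↔⊎) ⊎-↔ ↔-refl)

  part : Layout → Part
  part (inj₁ (inj₁ x))        = X x
  part (inj₁ (inj₂ (inj₁ y))) = Y y
  part (inj₁ (inj₂ (inj₂ _))) = Z
  part (inj₂ _)               = Z

  classify : Fin N → Part
  classify = part ∘ Inverse.to layout

  ∑-classify : (g : Part → ℕ) →
               ∑[ v < N ] g (classify v) ≡ ∑[ x < m ] g (X x) + ∑[ y < m ] g (Y y) + (m + d) * g Z
  ∑-classify g = begin
    ∑[ v < N ] g (classify v)
      ≡⟨ ∑-splitAt (3 * m) (λ s → g (part (Sum.map (Sum.map id (splitAt m) ∘ splitAt m) id s))) ⟩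
    ∑[ u < 3 * m ] g (part (inj₁ (Sum.map id (splitAt m) (splitAt m u)))) + ∑[ j < d ] g Z
      ≡⟨ cong (_+ ∑[ j < d ] g Z) (∑-splitAt m (λ s → g (part (inj₁ (Sum.map id (splitAt m) s))))) ⟩
    ∑[ x < m ] g (X x) + ∑[ u < 2 * m ] g (part (inj₁ (inj₂ (splitAt m u)))) + ∑[ j < d ] g Z
      ≡⟨ cong (λ s → ∑[ x < m ] g (X x) + s + ∑[ j < d ] g Z)
              (∑-splitAt m (λ s → g (part (inj₁ (inj₂ s))))) ⟩
    ∑[ x < m ] g (X x) + (∑[ y < m ] g (Y y) + ∑[ j < 1 * m ] g Z) + ∑[ j < d ] g Z
      ≡⟨ cong₂ (λ s t → ∑[ x < m ] g (X x) + (∑[ y < m ] g (Y y) + s) + t)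
               (∑-const (1 * m) (g Z)) (∑-const d (g Z)) ⟩
    ∑[ x < m ] g (X x) + (∑[ y < m ] g (Y y) + 1 * m * g Z) + d * g Z
      ≡⟨ regroup (∑[ x < m ] g (X x)) (∑[ y < m ] g (Y y)) (g Z) m d ⟩
    ∑[ x < m ] g (X x) + ∑[ y < m ] g (Y y) + (m + d) * g Z ∎
    where
    open ≡-Reasoning
    regroup : ∀ a b c m d → a + (b + 1 * m * c) + d * c ≡ a + b + (m + d) * c
    regroup = solve-∀

  card-classify : (S : Part → Bool) →
                  card (S ∘ classify) ≡ card (S ∘ X) + card (S ∘ Y) + (m + d) * indicator (S Z)
  card-classify S =
    trans (card≡∑ (S ∘ classify))
          (trans (∑-classify (indicator ∘ S))
                 (cong₂ (λ a b → a + b + (m + d) * indicator (S Z))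
                        (sym (card≡∑ (S ∘ X))) (sym (card≡∑ (S ∘ Y)))))

  brushes-classify : (g : Part → ℕ) →
                     brushes (g ∘ classify) ≡ brushes (g ∘ X) + brushes (g ∘ Y) + (m + d) * g Z
  brushes-classify g =
    trans (sum-map-allFin (g ∘ classify))
          (trans (∑-classify g)
                 (cong₂ (λ a b → a + b + (m + d) * g Z)
                        (sym (sum-map-allFin (g ∘ X))) (sym (sum-map-allFin (g ∘ Y)))))

  swapXY : Permutation′ m → Part → Part
  swapXY π (X x) = Y x
  swapXY π (Y y) = X (π ⟨$⟩ʳ y)
  swapXY π Z     = Z

  swapLayout : Permutation′ m → Layout ↔ Layout
  swapLayout π = mk↔ₛ′ to from to∘from from∘to
    where
    to : Layout → Layout
    to (inj₁ (inj₁ x))        = inj₁ (inj₂ (inj₁ x))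
    to (inj₁ (inj₂ (inj₁ y))) = inj₁ (inj₁ (π ⟨$⟩ʳ y))
    to l                      = l
    from : Layout → Layout
    from (inj₁ (inj₁ x))        = inj₁ (inj₂ (inj₁ (π ⟨$⟩ˡ x)))
    from (inj₁ (inj₂ (inj₁ y))) = inj₁ (inj₁ y)
    from l                      = l
    to∘from : ∀ l → to (from l) ≡ l
    to∘from (inj₁ (inj₁ x))        = cong (inj₁ ∘ inj₁) (inverseʳ π)
    to∘from (inj₁ (inj₂ (inj₁ y))) = refl
    to∘from (inj₁ (inj₂ (inj₂ z))) = refl
    to∘from (inj₂ z)               = refl
    from∘to : ∀ l → from (to l) ≡ l
    from∘to (inj₁ (inj₁ x))        = refl
    from∘to (inj₁ (inj₂ (inj₁ y))) = cong (inj₁ ∘ inj₂ ∘ inj₁) (inverseˡ π)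
    from∘to (inj₁ (inj₂ (inj₂ z))) = refl
    from∘to (inj₂ z)               = refl

  liftPerm : Permutation′ m → Permutation′ N
  liftPerm π = ↔-trans layout (↔-trans (swapLayout π) (↔-sym layout))

  classify-liftPerm : ∀ π v → classify (liftPerm π ⟨$⟩ʳ v) ≡ swapXY π (classify v)
  classify-liftPerm π v =
    trans (cong part (Inverse.strictlyInverseˡ layout _)) (part-swap (Inverse.to layout v))
    where
    part-swap : ∀ l → part (Inverse.to (swapLayout π) l) ≡ swapXY π (part l)
    part-swap (inj₁ (inj₁ x))        = refl
    part-swap (inj₁ (inj₂ (inj₁ y))) = refl
    part-swap (inj₁ (inj₂ (inj₂ z))) = refl
    part-swap (inj₂ z)               = refl

  module Simulation (ω : Config m) (ω<m : ∀ v → ω v < m) where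

    -- the number of vertices in Y ∪ Z
    shift : ℕ
    shift = m + (m + d)

    shift≡ : shift ≡ suc (m + (m + e))
    shift≡ = trans (cong (m +_) (+-suc m e)) (+-suc m (m + e))

    m+e+m≡m+[m+e] : m + e + m ≡ m + (m + e)
    m+e+m≡m+[m+e] = trans (+-assoc m e m) (cong (m +_) (+-comm e m))

    embedDirty : VSet m → Part → Bool
    embedDirty D (X x) = D x
    embedDirty D (Y _) = true
    embedDirty D Z     = true

    -- Each cleaned vertex of X has sent one brush to every vertex of Y ∪ Z.
    embedWeight : VSet m → Config m → Part → ℕ
    embedWeight D w (X x) = if D x then w x + shift else w x
    embedWeight D w (Y y) = ω y + card (∁ D)
    embedWeight D w Z     = m + e + card (∁ D)

    embed : State m → State N
    embed (D , w) = embedDirty D ∘ classify , embedWeight D w ∘ classify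

    embed-cong : ∀ {s s′} → s ≋ s′ → embed s ≋ embed s′
    embed-cong {D , w} {D′ , w′} (D≗D′ , w≗w′) = dirty ∘ classify , weight ∘ classify
      where
      dirty : ∀ p → embedDirty D p ≡ embedDirty D′ p
      dirty (X x) = D≗D′ x
      dirty (Y _) = refl
      dirty Z     = refl
      weight : ∀ p → embedWeight D w p ≡ embedWeight D′ w′ p
      weight (X x) = cong₂ (λ b k → if b then k + shift else k) (D≗D′ x) (w≗w′ x)
      weight (Y y) = cong (ω y +_) (card-cong (cong not ∘ D≗D′))
      weight Z     = cong (m + e +_) (card-cong (cong not ∘ D≗D′))

    card-embed : ∀ D → card (embedDirty D ∘ classify) ≡ card D + shift
    card-embed D = begin
      card (embedDirty D ∘ classify)
        ≡⟨ card-classify (embedDirty D) ⟩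
      card D + card (full {m}) + (m + d) * 1
        ≡⟨ cong₂ (λ a b → card D + a + b) (card-full m) (*-identityʳ (m + d)) ⟩
      card D + m + (m + d)
        ≡⟨ +-assoc (card D) m (m + d) ⟩
      card D + shift
        ∎
      where open ≡-Reasoning

    onX : VSet m → Part → Bool
    onX R (X x) = R x
    onX R (Y _) = false
    onX R Z     = false

    card-onX : ∀ R → card (onX R ∘ classify) ≡ card R
    card-onX R = begin
      card (onX R ∘ classify)
        ≡⟨ card-classify (onX R) ⟩
      card R + card (∅ {m}) + (m + d) * 0
        ≡⟨ cong₂ (λ a b → card R + a + b) (card-∅ m) (*-zeroʳ (m + d)) ⟩
      card R + 0 + 0
        ≡⟨ cong (_+ 0) (+-identityʳ (card R)) ⟩
      card R + 0
        ≡⟨ +-identityʳ (card R) ⟩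
      card R
        ∎
      where open ≡-Reasoning

    Y-weight< : ∀ D y → ω y + card (∁ D) < m + m
    Y-weight< D y = +-mono-<-≤ (ω<m y) (card-∁≤ D)

    Z-weight≤ : ∀ D → m + e + card (∁ D) ≤ m + (m + e)
    Z-weight≤ D = ≤-trans (+-monoʳ-≤ (m + e) (card-∁≤ D)) (≤-reflexive m+e+m≡m+[m+e])

    threshold-embed : ∀ {D c} → card D ≡ suc c → card (embedDirty D ∘ classify) ∸ 1 ≡ c + shift
    threshold-embed {D} |D| = cong (_∸ 1) (trans (card-embed D) (cong (_+ shift) |D|))

    cleanable-embed : ∀ {D w c} → card D ≡ suc c →
                      cleanable (embedDirty D ∘ classify) (embedWeight D w ∘ classify)
                      ≗ onX (cleanable D w) ∘ classify
    cleanable-embed {D} {w} {c} |D| v rewrite threshold-embed {D} |D| = at (classify v)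
      where
      shift≤ : shift ≤ c + shift
      shift≤ = m≤n+m shift c
      at : ∀ p → embedDirty D p ∧ (c + shift ≤ᵇ embedWeight D w p) ≡ onX (cleanable D w) p
      at (X x) with D x
      ... | false = refl
      ... | true  = trans (≤ᵇ-+ʳ c (w x) shift) (cong (λ k → k ∸ 1 ≤ᵇ w x) (sym |D|))
      at (Y y) = ≤ᵇ-false (<-≤-trans (Y-weight< D y) (≤-trans (+-monoʳ-≤ m (m≤m+n m d)) shift≤))
      at Z     = ≤ᵇ-false (<-≤-trans (≤-<-trans (Z-weight≤ D) (≤-reflexive (sym shift≡))) shift≤)

    afterRound-embed : ∀ {D w R c} → card D ≡ suc c → R ⊆ D →
                       afterRound (embedDirty D ∘ classify) (embedWeight D w ∘ classify) (onX R ∘ classify)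
                       ≋ embed (afterRound D w R)
    afterRound-embed {D} {w} {R} {c} |D| R⊆D = dirty ∘ classify , weight ∘ classify
      where
      dirty : ∀ p → embedDirty D p ∧ not (onX R p) ≡ embedDirty (D ∖ R) p
      dirty (X x) = refl
      dirty (Y _) = refl
      dirty Z     = refl
      at : ∀ p → (if onX R p then embedWeight D w p ∸ (c + shift) + (card R ∸ 1)
                  else if embedDirty D p then embedWeight D w p + card R else embedWeight D w p)
                 ≡ embedWeight (D ∖ R) (proj₂ (afterRound D w R)) p
      at (X x) with D x in Dx | R x in Rx
      ... | false | false = refl
      ... | false | true  = contradiction (trans (sym Rx) (R⊆D x Dx)) λ ()
      ... | true  | true  = cong (_+ (card R ∸ 1))
                                 (trans (+-comm-∸ (w x) c shift) (cong (w x ∸_) (cong (_∸ 1) (sym |D|))))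
        where
        +-comm-∸ : ∀ a b k → a + k ∸ (b + k) ≡ a ∸ b
        +-comm-∸ a b k = trans (cong₂ _∸_ (+-comm a k) (+-comm b k)) ([m+n]∸[m+o]≡n∸o k a b)
      ... | true  | false = +-right-comm (w x) shift (card R)
        where
        +-right-comm : ∀ a b k → a + b + k ≡ a + k + b
        +-right-comm = solve-∀
      at (Y y) = trans (+-assoc (ω y) _ (card R)) (cong (ω y +_) (sym (card-∁-∖ R⊆D)))
      at Z     = trans (+-assoc (m + e) _ (card R)) (cong (m + e +_) (sym (card-∁-∖ R⊆D)))
      weight : ∀ p → (if onX R p then embedWeight D w p ∸ (card (embedDirty D ∘ classify) ∸ 1)
                                      + (card (onX R ∘ classify) ∸ 1)
                      else if embedDirty D p then embedWeight D w p + card (onX R ∘ classify)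
                      else embedWeight D w p)
                     ≡ embedWeight (D ∖ R) (proj₂ (afterRound D w R)) p
      weight p rewrite threshold-embed {D} |D| | card-onX R = at p

    step-embed : ∀ {D w c} → card D ≡ suc c →
                 step (complete N) (embed (D , w)) ≋ embed (step (complete m) (D , w))
    step-embed {D} {w} {c} |D| = byCard (card (cleanable D w)) refl
      where
      byCard : ∀ k → card (cleanable D w) ≡ k →
               step (complete N) (embed (D , w)) ≋ embed (step (complete m) (D , w))
      byCard zero |ρ| =
        ≋-trans (step-complete-idle λ v → trans (cleanable-embed |D| v) (onX-∅ (classify v)))
                (embed-cong (≋-sym (step-complete-idle ρ≗∅)))
        where
        ρ≗∅ : cleanable D w ≗ ∅
        ρ≗∅ = card≡0⇒∅ (cleanable D w) |ρ|
        onX-∅ : ∀ p → onX (cleanable D w) p ≡ false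
        onX-∅ (X x) = ρ≗∅ x
        onX-∅ (Y _) = refl
        onX-∅ Z     = refl
      byCard (suc r) |ρ| =
        ≋-trans (step-complete-fire (cleanable-embed |D|) (trans (card-onX (cleanable D w)) |ρ|))
                (≋-trans (afterRound-embed |D| ρ⊆D)
                         (embed-cong (≋-sym (step-complete-fire (λ _ → refl) |ρ|))))
        where
        ρ⊆D : cleanable D w ⊆ D
        ρ⊆D x Dx = cong (_∧ (card D ∸ 1 ≤ᵇ w x)) Dx

    onY : Part → Bool
    onY (X _) = false
    onY (Y _) = true
    onY Z     = false

    finalWeight : Config m → Part → ℕ
    finalWeight w (X x) = w x
    finalWeight w (Y y) = ω y + shift
    finalWeight w Z     = m + e

    cleaned : Config m → State N
    cleaned w = ∅ , finalWeight w ∘ classify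

    cleaned-cong : ∀ {w w′} → w ≗ w′ → cleaned w ≋ cleaned w′
    cleaned-cong {w} {w′} w≗w′ = (λ _ → refl) , weight ∘ classify
      where
      weight : ∀ p → finalWeight w p ≡ finalWeight w′ p
      weight (X x) = w≗w′ x
      weight (Y _) = refl
      weight Z     = refl

    step-embed-clean : ∀ {D w} → D ≗ ∅ →
                       step (complete N) (embed (D , w)) ≋ (onY ∘ classify , finalWeight w ∘ classify)
    step-embed-clean {D} {w} D≗∅ =
      ≋-trans (step-complete-fire (λ v → cleanable≗Z (classify v)) |Z|)
              (dirty ∘ classify , weight ∘ classify)
      where
      onZ : Part → Bool
      onZ (X _) = false
      onZ (Y _) = false
      onZ Z     = true
      |D| : card D ≡ 0
      |D| = trans (card-cong D≗∅) (card-∅ m)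
      |∁D| : card (∁ D) ≡ m
      |∁D| = trans (cong (_+ card (∁ D)) (sym |D|)) (card+card-∁ D)
      threshold : card (embedDirty D ∘ classify) ∸ 1 ≡ m + (m + e)
      threshold = cong (_∸ 1) (trans (card-embed D) (trans (cong (_+ shift) |D|) shift≡))
      |Z| : card (onZ ∘ classify) ≡ suc (m + e)
      |Z| = trans (card-classify onZ)
                  (trans (cong₂ (λ a b → a + b + (m + d) * 1) (card-∅ m) (card-∅ m))
                         (trans (*-identityʳ (m + d)) (+-suc m e)))
      cleanable≗Z : ∀ p → embedDirty D p ∧ (card (embedDirty D ∘ classify) ∸ 1 ≤ᵇ embedWeight D w p)
                          ≡ onZ p
      cleanable≗Z (X x) rewrite D≗∅ x = refl
      cleanable≗Z (Y y) rewrite threshold =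
        ≤ᵇ-false (<-≤-trans (Y-weight< D y) (+-monoʳ-≤ m (m≤m+n m e)))
      cleanable≗Z Z rewrite threshold | |∁D| = ≤ᵇ-true (≤-reflexive (sym m+e+m≡m+[m+e]))
      dirty : ∀ p → embedDirty D p ∧ not (onZ p) ≡ onY p
      dirty (X x) = trans (∧-identityʳ (D x)) (D≗∅ x)
      dirty (Y _) = refl
      dirty Z     = refl
      weight : ∀ p → (if onZ p then embedWeight D w p ∸ (card (embedDirty D ∘ classify) ∸ 1)
                                      + (card (onZ ∘ classify) ∸ 1)
                      else if embedDirty D p then embedWeight D w p + card (onZ ∘ classify)
                      else embedWeight D w p)
                     ≡ finalWeight w p
      weight (X x) rewrite D≗∅ x = refl
      weight (Y y) rewrite |Z| | |∁D| =
        trans (+-assoc (ω y) m (suc (m + e))) (cong (λ k → ω y + (m + k)) (sym (+-suc m e)))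
      weight Z rewrite threshold | |Z| | |∁D| | m+e+m≡m+[m+e] | n∸n≡0 (m + (m + e)) = refl

    card-onY : card (onY ∘ classify) ≡ m
    card-onY = trans (card-classify onY)
                     (trans (cong₂ (λ a b → a + b + (m + d) * 0) (card-∅ m) (card-full m))
                            (trans (cong (m +_) (*-zeroʳ (m + d))) (+-identityʳ m)))

    step-onY : ∀ w → step (complete N) (onY ∘ classify , finalWeight w ∘ classify) ≋ cleaned w
    step-onY w = step-complete-all λ v → enough (classify v)
      where
      enough : ∀ p → onY p ≡ true → card (onY ∘ classify) ∸ 1 ≤ finalWeight w p
      enough (X _) ()
      enough Z     ()
      enough (Y y) _ = begin
        card (onY ∘ classify) ∸ 1 ≤⟨ m∸n≤m _ 1 ⟩
        card (onY ∘ classify)     ≡⟨ card-onY ⟩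
        m                         ≤⟨ m≤m+n m (m + d) ⟩
        shift                     ≤⟨ m≤n+m shift (ω y) ⟩
        ω y + shift               ∎
        where open ≤-Reasoning

    iterate-embed-clean : ∀ {D w j} → D ≗ ∅ → 2 ≤ j →
                          iterate j (step (complete N)) (embed (D , w)) ≋ cleaned w
    iterate-embed-clean {j = suc (suc j)} D≗∅ (s≤s (s≤s _)) =
      ≋-trans (iterate-cong (complete N) j
                 (≋-trans (step-cong (complete N) (step-embed-clean D≗∅)) (step-onY _)))
              (iterate-complete-clean j λ _ → refl)

    iterate-embed : ∀ k {j} → 2 ≤ j → (s : State m) → proj₁ (iterate k (step (complete m)) s) ≗ ∅ →
                    iterate (k + j) (step (complete N)) (embed s)
                    ≋ cleaned (proj₂ (iterate k (step (complete m)) s))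
    iterate-embed zero        2≤j (D , w) D≗∅   = iterate-embed-clean D≗∅ 2≤j
    iterate-embed (suc k) {j} 2≤j (D , w) clean = byCard (card D) refl
      where
      byCard : ∀ c → card D ≡ c → iterate (suc k + j) (step (complete N)) (embed (D , w))
                                   ≋ cleaned (proj₂ (iterate (suc k) (step (complete m)) (D , w)))
      byCard zero |D| =
        ≋-trans (iterate-embed-clean D≗∅ (≤-trans 2≤j (m≤n+m j (suc k))))
                (cleaned-cong λ x → sym (proj₂ (iterate-complete-clean (suc k) D≗∅) x))
        where
        D≗∅ : D ≗ ∅
        D≗∅ = card≡0⇒∅ D |D|
      byCard (suc c) |D| =
        ≋-trans (iterate-cong (complete N) (k + j) (step-embed |D|))
                (iterate-embed k 2≤j (step (complete m) (D , w)) clean)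

    initialWeight : Part → ℕ
    initialWeight (X x) = ω x + shift
    initialWeight (Y y) = ω y
    initialWeight Z     = m + e

    blowUp : Config N
    blowUp = initialWeight ∘ classify

    blowUp≋embed : (full , blowUp) ≋ embed (full , ω)
    blowUp≋embed = dirty ∘ classify , weight ∘ classify
      where
      dirty : ∀ p → true ≡ embedDirty full p
      dirty (X _) = refl
      dirty (Y _) = refl
      dirty Z     = refl
      nothing-clean : ∀ k → k ≡ k + card (∁ (full {m}))
      nothing-clean k = sym (trans (cong (k +_) (card-∅ m)) (+-identityʳ k))
      weight : ∀ p → initialWeight p ≡ embedWeight full ω p
      weight (X _) = refl
      weight (Y y) = nothing-clean (ω y)
      weight Z     = nothing-clean (m + e)

    blowUp-final : 2 ≤ 2 * m + d → Cleans (complete m) ω →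
                   final (complete N) blowUp ≋ cleaned (finalConfig (complete m) ω)
    blowUp-final 2≤ clean =
      ≋-trans (iterate-cong (complete N) N blowUp≋embed)
              (subst (λ k → iterate k (step (complete N)) (embed (full , ω))
                            ≋ cleaned (finalConfig (complete m) ω))
                     (sym (+-assoc m (2 * m) d))
                     (iterate-embed m 2≤ (full , ω) clean))

    N≡m+shift : N ≡ m + shift
    N≡m+shift = lemma m d
      where
      lemma : ∀ m d → 3 * m + d ≡ m + (m + (m + d))
      lemma = solve-∀

    initialWeight<N : ∀ p → initialWeight p < N
    initialWeight<N p = subst (initialWeight p <_) (sym N≡m+shift) (below p)
      where
      below : ∀ p → initialWeight p < m + shift
      below (X x) = +-monoˡ-< shift (ω<m x)
      below (Y y) = <-≤-trans (ω<m y) (m≤m+n m shift)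
      below Z     = +-monoʳ-< m (<-≤-trans (n<1+n e) (≤-trans (m≤n+m d m) (m≤n+m (m + d) m)))

    blowUp-oneClique : 2 ≤ 2 * m + d → OneClique m ω → OneClique N blowUp
    blowUp-oneClique 2≤ (clean , _ , π , final∘π≗ω) = proj₁ final≋ , bounded , liftPerm π , permuted
      where
      final≋ : final (complete N) blowUp ≋ cleaned (finalConfig (complete m) ω)
      final≋ = blowUp-final 2≤ clean
      bounded : ∀ v → blowUp v ≤ N ∸ 1
      bounded v = suc[m]≤n⇒m≤pred[n] (initialWeight<N (classify v))
      swapped : ∀ p → finalWeight (finalConfig (complete m) ω) (swapXY π p) ≡ initialWeight p
      swapped (X x) = refl
      swapped (Y y) = final∘π≗ω y
      swapped Z     = refl
      permuted : ∀ v → finalConfig (complete N) blowUp (liftPerm π ⟨$⟩ʳ v) ≡ blowUp v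
      permuted v = trans (proj₂ final≋ (liftPerm π ⟨$⟩ʳ v))
                         (trans (cong (finalWeight _) (classify-liftPerm π v)) (swapped (classify v)))

    brushes-blowUp : brushes blowUp ≡ brushes ω + m * shift + brushes ω + (m + d) * (m + e)
    brushes-blowUp =
      trans (brushes-classify initialWeight) (cong (λ a → a + brushes ω + (m + d) * (m + e)) shifted)
      where
      shifted : brushes (λ x → ω x + shift) ≡ brushes ω + m * shift
      shifted = trans (sum-map-allFin (λ x → ω x + shift))
                      (trans (∑-distrib-+ ω (λ _ → shift))
                             (cong₂ _+_ (sym (sum-map-allFin ω)) (∑-const m shift)))

    brushes-blowUp-exact : 3 * brushes blowUp + d ≡ 6 * brushes ω + N * N + e * (3 * m + 2 * d)
    brushes-blowUp-exact = trans (cong (λ b → 3 * b + d) brushes-blowUp) (identity (brushes ω) m e)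
      where
      identity : ∀ S m e → 3 * (S + m * (m + (m + suc e)) + S + (m + suc e) * (m + e)) + suc e
                           ≡ 6 * S + (3 * m + suc e) * (3 * m + suc e) + e * (3 * m + 2 * suc e)
      identity = solve-∀

≡-up-to-slack : ∀ {a b p q r} → a + p ≡ b + q → p ≤ r → q ≤ r → a ≤ b + r × b ≤ a + r
≡-up-to-slack {a} {b} {p} {q} a+p≡b+q p≤r q≤r =
  ≤-trans (m≤m+n a p) (≤-trans (≤-reflexive a+p≡b+q) (+-monoʳ-≤ b q≤r)) ,
  ≤-trans (m≤m+n b q) (≤-trans (≤-reflexive (sym a+p≡b+q)) (+-monoʳ-≤ a p≤r))

≤pred⇒< : ∀ {m a} → Fin m → a ≤ m ∸ 1 → a < m
≤pred⇒< {suc m} _ a≤m = s≤s a≤m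

Extension : ∀ {m} → ℕ → ℕ → Config m → Set
Extension N C ω = ∃[ ω′ ] (OneClique N ω′
                    × 3 * brushes ω′ ≤ 6 * brushes ω + N * N + C * N
                    × 6 * brushes ω + N * N ≤ 3 * brushes ω′ + C * N)

K₁-oneClique : OneClique 1 (λ _ → 0)
K₁-oneClique = (λ { zero → refl }) , (λ _ → z≤n) , idₚ , λ { zero → refl }

blowUp-extension : ∀ m e → e ≤ 2 → 2 ≤ 2 * m + suc e → (ω : Config m) → OneClique m ω →
                   Extension (3 * m + suc e) 4 ω
blowUp-extension m e e≤2 2≤ ω clique@(_ , ω≤ , _) =
  blowUp , blowUp-oneClique 2≤ clique , ≡-up-to-slack brushes-blowUp-exact d≤4N slack≤4N
  where
  open BlowUp m e
  open Simulation ω (λ v → ≤pred⇒< v (ω≤ v))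
  d≤4N : d ≤ 4 * N
  d≤4N = ≤-trans (m≤n+m d (3 * m)) (m≤m+n N (3 * N))
  slack≤4N : e * (3 * m + 2 * d) ≤ 4 * N
  slack≤4N = ≤-trans (*-monoˡ-≤ (3 * m + 2 * d) e≤2)
                     (≤-trans (m≤m+n (2 * (3 * m + 2 * d)) (6 * m)) (≤-reflexive (sym (regroup m d))))
    where
    regroup : ∀ m d → 4 * (3 * m + d) ≡ 2 * (3 * m + 2 * d) + 6 * m
    regroup = solve-∀

-- For m = 0 and d = 1 the blow-up needs two rounds after X is clean, but K₁ only runs one.
extension : ∀ m e → e ≤ 2 → (ω : Config m) → OneClique m ω → Extension (3 * m + suc e) 4 ω
extension zero    zero    _   _ _      = (λ _ → 0) , K₁-oneClique , z≤n , s≤s z≤n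
extension zero    (suc e) e≤2 ω clique = blowUp-extension zero (suc e) e≤2 (s≤s (s≤s z≤n)) ω clique
extension (suc m) e       e≤2 ω clique =
  blowUp-extension (suc m) e e≤2 (≤-trans (*-monoʳ-≤ 2 (s≤s z≤n)) (m≤m+n (2 * suc m) (suc e))) ω clique

mainTheorem7 : ∃[ C ] ((m d : ℕ) → 1 ≤ d → d ≤ 3 → (ω : Config m) → OneClique m ω →
    ∃[ ω′ ] (OneClique (3 * m + d) ω′
      × 3 * brushes ω′ ≤ 6 * brushes ω + (3 * m + d) * (3 * m + d) + C * (3 * m + d)
      × 6 * brushes ω + (3 * m + d) * (3 * m + d) ≤ 3 * brushes ω′ + C * (3 * m + d)))
mainTheorem7 = 4 , λ where
  m zero    ()  _
  m (suc e) _   (s≤s e≤2) → extension m e e≤2
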